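{- Let $\tilde\alpha\in\{0,1\}^n$ and let $\alpha_k=0$. Then $\alpha_k$ is bound in $\tilde\alpha$ if and only if there exists a $1$-dominated segment of $\tilde\alpha$ succeeding $\alpha_k$.
   Context: Indices are cyclic modulo $n$. For $i,j\in\{1,\dots,n\}$ the segment $\tilde\alpha[i:j]$ is $(\alpha_i,\dots,\alpha_j)$ if $i\le j$ and $(\alpha_i,\dots,\alpha_n,\alpha_1,\dots,\alpha_j)$ if $i>j$ (traversed cyclically from $i$ to $j$). Its prefixes are the segments $\tilde\alpha[i:j']$ with $j'$ strictly before $j$ in this cyclic traversal starting at $i$. A segment is balanced / $0$-dominated / $1$-dominated if its number of zeros is equal to / greater than / less than its number of ones. A minimal balanced segment is a balanced segment every prefix of which is $0$-dominated. A component $\alpha_i=0$ and a component $\alpha_j=1$ are connected (to each other) if $\tilde\alpha[i:j]$ is a minimal balanced segment. A component is bound if it is connected to some component, unbound otherwise. A segment $\tilde\alpha[l:m]$ succeeds the component $\alpha_{l-1}$ (the component $\alpha_n$ if $l=1$). -}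

module Defs where

open import Data.Bool using (Bool; true; false)
open import Data.Nat using (ℕ; zero; suc; _+_; _∸_; _<_; _%_)
open import Data.Nat.DivMod using (m%n<n)
open import Data.Fin using (Fin; toℕ; fromℕ<)
open import Data.List using (List; []; _∷_; map; upTo)
open import Data.Product using (_×_; ∃-syntax)
open import Data.Sum using (_⊎_)
open import Relation.Binary.PropositionalEquality using (_≡_)

-- A cyclic word α̃ ∈ {0,1}^n is a function Fin n → Bool, with false = 0, true = 1.
-- Positions are 0-based (Fin n); position p corresponds to index p+1 of the paper.

shift : ∀ {n} → Fin n → ℕ → Fin n
shift {suc n} i t = fromℕ< (m%n<n (toℕ i + t) (suc n))

dist : ∀ {n} → Fin n → Fin n → ℕ
dist {suc n} i j = (toℕ j + suc n ∸ toℕ i) % suc n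

seg : ∀ {n} → (Fin n → Bool) → Fin n → Fin n → List Bool
seg α i j = map (λ t → α (shift i t)) (upTo (suc (dist i j)))

zeros : List Bool → ℕ
zeros [] = 0
zeros (false ∷ l) = suc (zeros l)
zeros (true ∷ l) = zeros l

ones : List Bool → ℕ
ones [] = 0
ones (false ∷ l) = ones l
ones (true ∷ l) = suc (ones l)

Balanced : List Bool → Set
Balanced s = zeros s ≡ ones s

ZeroDominated : List Bool → Set
ZeroDominated s = ones s < zeros s

OneDominated : List Bool → Set
OneDominated s = zeros s < ones s

MinimalBalanced : ∀ {n} → (Fin n → Bool) → Fin n → Fin n → Set
MinimalBalanced α i j =
  Balanced (seg α i j) × (∀ j' → dist i j' < dist i j → ZeroDominated (seg α i j'))

ConnectedOrdered : ∀ {n} → (Fin n → Bool) → Fin n → Fin n → Set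
ConnectedOrdered α i j = α i ≡ false × α j ≡ true × MinimalBalanced α i j

Connected : ∀ {n} → (Fin n → Bool) → Fin n → Fin n → Set
Connected α x y = ConnectedOrdered α x y ⊎ ConnectedOrdered α y x

Bound : ∀ {n} → (Fin n → Bool) → Fin n → Set
Bound α x = ∃[ y ] Connected α x y

-- A segment α̃[l:m] succeeds α_{l-1}; so the segments succeeding α_k are α̃[k+1:m].
SucceedingOneDominated : ∀ {n} → (Fin n → Bool) → Fin n → Set
SucceedingOneDominated α k = ∃[ m ] OneDominated (seg α (shift k 1) m)

module Submission where

-- Reading α̃ cyclically from position i gives the
-- sequence  walk α i t = α_{i+t},  and every segment α̃[i:j] is the prefix of
-- length  dist i j + 1  of this sequence.  Put  g = walk α k,  so g 0 = 0.
--  (⇒) A bound zero α_k is the 0-end of a minimal balanced segment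
--      α̃[k:y] = 0 ∷ α̃[k+1:y];  deleting the leading zero of a balanced word
--      leaves a 1-dominated word, and α̃[k+1:y] succeeds α_k.
--  (⇐) If α̃[k+1:m] is 1-dominated, the prefix 0 ∷ α̃[k+1:m] of g is not
--      0-dominated although its first letter is.  Every letter moves the
--      zero/one balance by one, so the first prefix of g that is not
--      0-dominated is balanced and ends in a 1 (the first crossing lemma).
--      It is shorter than a full turn, because after n steps g is back at
--      α_k = 0; hence it is a minimal balanced segment from α_k to a 1.
-- The file develops, in order: arithmetic of cyclic positions, segments as
-- prefixes of walks, counting facts about words, the first crossing lemma
-- for 0/1 sequences, and finally the two directions of the theorem.

open import Defs
open import Data.Nat using (ℕ; zero; suc; _+_; _∸_; _<_; _≤_; _%_; z≤n; s≤s; s≤s⁻¹; _<?_)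
open import Data.Nat.Properties
open import Data.Nat.DivMod using (m%n<n; m<n⇒m%n≡m; [m+n]%n≡m%n; m%n%n≡m%n; %-distribˡ-+; m≤n⇒[n∸m]%m≡n%m)
open import Data.Bool using (Bool; false; true)
open import Data.Fin using (Fin; toℕ)
open import Data.Fin.Properties using (toℕ-fromℕ<; toℕ-injective; toℕ<n)
open import Data.List using ([]; _∷_; _∷ʳ_; applyUpTo)
open import Data.List.Properties using (map-cong; map-upTo; applyUpTo-∷ʳ)
open import Data.Product using (_×_; _,_; ∃-syntax)
open import Data.Sum using (_⊎_; inj₁; inj₂)
open import Data.Empty using (⊥-elim)
open import Function using (_∘_)
open import Relation.Nullary using (yes; no; ¬_)
open import Relation.Binary.PropositionalEquality

%-absorbˡ : ∀ m t d → (m % suc d + t) % suc d ≡ (m + t) % suc d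
%-absorbˡ m t d = begin
  (m % N + t) % N           ≡⟨ %-distribˡ-+ (m % N) t N ⟩
  (m % N % N + t % N) % N   ≡⟨ cong (λ x → (x + t % N) % N) (m%n%n≡m%n m N) ⟩
  (m % N + t % N) % N       ≡⟨ %-distribˡ-+ m t N ⟨
  (m + t) % N               ∎
  where open ≡-Reasoning
        N = suc d

toℕ-shift : ∀ {n} (i : Fin (suc n)) t → toℕ (shift i t) ≡ (toℕ i + t) % suc n
toℕ-shift {n} i t = toℕ-fromℕ< (m%n<n (toℕ i + t) (suc n))

shift-zero : ∀ {n} (i : Fin (suc n)) → shift i 0 ≡ i
shift-zero {n} i = toℕ-injective (begin
  toℕ (shift i 0)      ≡⟨ toℕ-shift i 0 ⟩
  (toℕ i + 0) % suc n  ≡⟨ cong (_% suc n) (+-identityʳ (toℕ i)) ⟩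
  toℕ i % suc n        ≡⟨ m<n⇒m%n≡m (toℕ<n i) ⟩
  toℕ i                ∎)
  where open ≡-Reasoning

shift-full-turn : ∀ {n} (i : Fin (suc n)) → shift i (suc n) ≡ i
shift-full-turn {n} i = toℕ-injective (begin
  toℕ (shift i (suc n))      ≡⟨ toℕ-shift i (suc n) ⟩
  (toℕ i + suc n) % suc n    ≡⟨ [m+n]%n≡m%n (toℕ i) (suc n) ⟩
  toℕ i % suc n              ≡⟨ m<n⇒m%n≡m (toℕ<n i) ⟩
  toℕ i                      ∎)
  where open ≡-Reasoning

shift-suc : ∀ {n} (i : Fin (suc n)) t → shift (shift i 1) t ≡ shift i (suc t)
shift-suc {n} i t = toℕ-injective (begin
  toℕ (shift (shift i 1) t)      ≡⟨ toℕ-shift (shift i 1) t ⟩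
  (toℕ (shift i 1) + t) % suc n  ≡⟨ cong (λ x → (x + t) % suc n) (toℕ-shift i 1) ⟩
  ((toℕ i + 1) % suc n + t) % suc n ≡⟨ %-absorbˡ (toℕ i + 1) t n ⟩
  (toℕ i + 1 + t) % suc n        ≡⟨ cong (_% suc n) (+-assoc (toℕ i) 1 t) ⟩
  (toℕ i + suc t) % suc n        ≡⟨ toℕ-shift i (suc t) ⟨
  toℕ (shift i (suc t))          ∎)
  where open ≡-Reasoning

dist<n : ∀ {n} (i j : Fin (suc n)) → dist i j < suc n
dist<n {n} i j = m%n<n (toℕ j + suc n ∸ toℕ i) (suc n)

shift-wraps-at-most-once : ∀ {n} (i : Fin (suc n)) t → t < suc n →
  toℕ (shift i t) ≡ toℕ i + t ⊎ toℕ (shift i t) + suc n ≡ toℕ i + t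
shift-wraps-at-most-once {n} i t t<N with toℕ i + t <? suc n
... | yes no-wrap = inj₁ (trans (toℕ-shift i t) (m<n⇒m%n≡m no-wrap))
... | no wrap = inj₂ (begin
  toℕ (shift i t) + N          ≡⟨ cong (_+ N) (toℕ-shift i t) ⟩
  (toℕ i + t) % N + N          ≡⟨ cong (_+ N) (m≤n⇒[n∸m]%m≡n%m N≤i+t) ⟨
  (toℕ i + t ∸ N) % N + N      ≡⟨ cong (_+ N) (m<n⇒m%n≡m reduced<N) ⟩
  toℕ i + t ∸ N + N            ≡⟨ m∸n+n≡m N≤i+t ⟩
  toℕ i + t                    ∎)
  where
    open ≡-Reasoning
    N = suc n
    N≤i+t : N ≤ toℕ i + t
    N≤i+t = ≮⇒≥ wrap
    reduced<N : toℕ i + t ∸ N < N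
    reduced<N = +-cancelʳ-< N (toℕ i + t ∸ N) N
      (subst (_< N + N) (sym (m∸n+n≡m N≤i+t)) (+-mono-< (toℕ<n i) t<N))

dist-shift : ∀ {n} (i : Fin (suc n)) t → t < suc n → dist i (shift i t) ≡ t
dist-shift {n} i t t<N with shift-wraps-at-most-once i t t<N
... | inj₁ no-wrap = begin
  (toℕ (shift i t) + N ∸ toℕ i) % N  ≡⟨ cong (λ x → (x + N ∸ toℕ i) % N) no-wrap ⟩
  (toℕ i + t + N ∸ toℕ i) % N        ≡⟨ cong (λ x → (x ∸ toℕ i) % N) (+-assoc (toℕ i) t N) ⟩
  (toℕ i + (t + N) ∸ toℕ i) % N      ≡⟨ cong (_% N) (m+n∸m≡n (toℕ i) (t + N)) ⟩
  (t + N) % N                        ≡⟨ [m+n]%n≡m%n t N ⟩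
  t % N                              ≡⟨ m<n⇒m%n≡m t<N ⟩
  t                                  ∎
  where open ≡-Reasoning
        N = suc n
... | inj₂ wrap = begin
  (toℕ (shift i t) + N ∸ toℕ i) % N  ≡⟨ cong (λ x → (x ∸ toℕ i) % N) wrap ⟩
  (toℕ i + t ∸ toℕ i) % N            ≡⟨ cong (_% N) (m+n∸m≡n (toℕ i) t) ⟩
  t % N                              ≡⟨ m<n⇒m%n≡m t<N ⟩
  t                                  ∎
  where open ≡-Reasoning
        N = suc n

walk : ∀ {n} → (Fin n → Bool) → Fin n → ℕ → Bool
walk α i t = α (shift i t)

walk-zero : ∀ {n} (α : Fin (suc n) → Bool) i → walk α i 0 ≡ α i
walk-zero α i = cong α (shift-zero i)

walk-full-turn : ∀ {n} (α : Fin (suc n) → Bool) i → walk α i (suc n) ≡ α i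
walk-full-turn α i = cong α (shift-full-turn i)

seg-as-walk : ∀ {n} (α : Fin n → Bool) i j → seg α i j ≡ applyUpTo (walk α i) (suc (dist i j))
seg-as-walk α i j = map-upTo (walk α i) (suc (dist i j))

seg-succeeding : ∀ {n} (α : Fin (suc n) → Bool) i j →
  seg α (shift i 1) j ≡ applyUpTo (walk α i ∘ suc) (suc (dist (shift i 1) j))
seg-succeeding α i j =
  trans (map-cong (cong α ∘ shift-suc i) _) (map-upTo (walk α i ∘ suc) (suc (dist (shift i 1) j)))

seg-to-shift : ∀ {n} (α : Fin (suc n) → Bool) i t → t < suc n →
  seg α i (shift i t) ≡ applyUpTo (walk α i) (suc t)
seg-to-shift α i t t<N =
  trans (seg-as-walk α i (shift i t)) (cong (applyUpTo (walk α i) ∘ suc) (dist-shift i t t<N))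

zeros-∷ʳ-false : ∀ l → zeros (l ∷ʳ false) ≡ suc (zeros l)
zeros-∷ʳ-false [] = refl
zeros-∷ʳ-false (false ∷ l) = cong suc (zeros-∷ʳ-false l)
zeros-∷ʳ-false (true ∷ l) = zeros-∷ʳ-false l

ones-∷ʳ-false : ∀ l → ones (l ∷ʳ false) ≡ ones l
ones-∷ʳ-false [] = refl
ones-∷ʳ-false (false ∷ l) = ones-∷ʳ-false l
ones-∷ʳ-false (true ∷ l) = cong suc (ones-∷ʳ-false l)

zeros-∷ʳ-true : ∀ l → zeros (l ∷ʳ true) ≡ zeros l
zeros-∷ʳ-true [] = refl
zeros-∷ʳ-true (false ∷ l) = cong suc (zeros-∷ʳ-true l)
zeros-∷ʳ-true (true ∷ l) = zeros-∷ʳ-true l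

ones-∷ʳ-true : ∀ l → ones (l ∷ʳ true) ≡ suc (ones l)
ones-∷ʳ-true [] = refl
ones-∷ʳ-true (false ∷ l) = ones-∷ʳ-true l
ones-∷ʳ-true (true ∷ l) = cong suc (ones-∷ʳ-true l)

-- One letter changes the balance by one: if appending b to a 0-dominated word
-- destroys 0-domination, then b is a one and the result is balanced.
crossing-step : ∀ l b → ZeroDominated l → ¬ ZeroDominated (l ∷ʳ b) →
  b ≡ true × Balanced (l ∷ʳ b)
crossing-step l false zd not-zd =
  ⊥-elim (not-zd (subst₂ _<_ (sym (ones-∷ʳ-false l)) (sym (zeros-∷ʳ-false l)) (m<n⇒m<1+n zd)))
crossing-step l true zd not-zd = refl , (begin
  zeros (l ∷ʳ true)  ≡⟨ zeros-∷ʳ-true l ⟩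
  zeros l            ≡⟨ ≤-antisym (≮⇒≥ not-zd′) zd ⟩
  suc (ones l)       ≡⟨ ones-∷ʳ-true l ⟨
  ones (l ∷ʳ true)   ∎)
  where
    open ≡-Reasoning
    not-zd′ : ¬ suc (ones l) < zeros l
    not-zd′ = not-zd ∘ subst₂ _<_ (sym (ones-∷ʳ-true l)) (sym (zeros-∷ʳ-true l))

balanced-tail : ∀ l → Balanced (false ∷ l) → OneDominated l
balanced-tail l = ≤-reflexive

one-dominated-cons : ∀ l → OneDominated l → ¬ ZeroDominated (false ∷ l)
one-dominated-cons l od zd = <⇒≱ od (s≤s⁻¹ zd)

PrefixesZeroDominated : (ℕ → Bool) → ℕ → Set
PrefixesZeroDominated g N = ∀ t → t < N → ZeroDominated (applyUpTo g (suc t))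

FirstCrossing : (ℕ → Bool) → ℕ → Set
FirstCrossing g T =
  g T ≡ true × Balanced (applyUpTo g (suc T)) × PrefixesZeroDominated g T

first-failure-crosses : ∀ (g : ℕ → Bool) → g 0 ≡ false → ∀ M →
  PrefixesZeroDominated g M → ¬ ZeroDominated (applyUpTo g (suc M)) → FirstCrossing g M
first-failure-crosses g g0 zero _ not-zd =
  ⊥-elim (not-zd (subst (λ b → ZeroDominated (b ∷ [])) (sym g0) (s≤s z≤n)))
first-failure-crosses g g0 (suc M) earlier not-zd
  with crossing-step (applyUpTo g (suc M)) (g (suc M)) (earlier M ≤-refl)
         (not-zd ∘ subst ZeroDominated (applyUpTo-∷ʳ g (suc M)))
... | ends-in-one , balanced =
  ends-in-one , subst Balanced (applyUpTo-∷ʳ g (suc M)) balanced , earlier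

crossing-dichotomy : ∀ (g : ℕ → Bool) → g 0 ≡ false → ∀ N →
  PrefixesZeroDominated g N ⊎ ∃[ T ] T < N × FirstCrossing g T
crossing-dichotomy g g0 zero = inj₁ (λ _ ())
crossing-dichotomy g g0 (suc N) with crossing-dichotomy g g0 N
... | inj₂ (T , T<N , crossing) = inj₂ (T , m<n⇒m<1+n T<N , crossing)
... | inj₁ earlier with ones (applyUpTo g (suc N)) <? zeros (applyUpTo g (suc N))
...   | no not-zd = inj₂ (N , n<1+n N , first-failure-crosses g g0 N earlier not-zd)
...   | yes zd = inj₁ extended
  where
    extended : PrefixesZeroDominated g (suc N)
    extended t t<1+N with m<1+n⇒m<n∨m≡n t<1+N
    ... | inj₁ t<N = earlier t t<N
    ... | inj₂ refl = zd

first-crossing : ∀ (g : ℕ → Bool) N → g 0 ≡ false → ¬ ZeroDominated (applyUpTo g (suc N)) →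
  ∃[ T ] T < suc N × FirstCrossing g T
first-crossing g N g0 not-zd with crossing-dichotomy g g0 (suc N)
... | inj₁ all-zd = ⊥-elim (not-zd (all-zd N ≤-refl))
... | inj₂ crossing = crossing

bound⇒succeeding : ∀ {n} (α : Fin (suc n) → Bool) k → α k ≡ false →
  Bound α k → SucceedingOneDominated α k
bound⇒succeeding α k αk≡0 (y , inj₂ (_ , αk≡1 , _)) with trans (sym αk≡0) αk≡1
... | ()
bound⇒succeeding {n} α k αk≡0 (y , inj₁ (_ , _ , balanced , _)) =
  tail-succeeds (dist k y) (dist<n k y) (balanced-tail (applyUpTo (walk α k ∘ suc) (dist k y)) balanced′)
  where
    balanced′ : Balanced (false ∷ applyUpTo (walk α k ∘ suc) (dist k y))
    balanced′ = subst (λ w → Balanced (w ∷ applyUpTo (walk α k ∘ suc) (dist k y)))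
                  (trans (walk-zero α k) αk≡0) (subst Balanced (seg-as-walk α k y) balanced)
    tail-succeeds : ∀ d → d < suc n → OneDominated (applyUpTo (walk α k ∘ suc) d) →
      SucceedingOneDominated α k
    tail-succeeds zero _ ()
    tail-succeeds (suc D) d<N od = shift (shift k 1) D , subst OneDominated (sym segment≡tail) od
      where
        segment≡tail : seg α (shift k 1) (shift (shift k 1) D) ≡ applyUpTo (walk α k ∘ suc) (suc D)
        segment≡tail = trans (seg-succeeding α k _)
          (cong (applyUpTo (walk α k ∘ suc) ∘ suc) (dist-shift (shift k 1) D (<-trans (n<1+n D) d<N)))

-- A first crossing of the walk from the zero α_k happens before a full turn,
-- since after n steps the walk is back at α_k.
crossing-before-full-turn : ∀ {n} (α : Fin (suc n) → Bool) k T → α k ≡ false →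
  T ≤ suc n → walk α k T ≡ true → T < suc n
crossing-before-full-turn α k T αk≡0 T≤N ends-in-one with m≤n⇒m<n∨m≡n T≤N
... | inj₁ T<N = T<N
... | inj₂ refl with trans (sym ends-in-one) (trans (walk-full-turn α k) αk≡0)
...   | ()

crossing⇒connected : ∀ {n} (α : Fin (suc n) → Bool) k T → α k ≡ false → T < suc n →
  FirstCrossing (walk α k) T → ConnectedOrdered α k (shift k T)
crossing⇒connected α k T αk≡0 T<N (ends-in-one , balanced , earlier) =
  αk≡0 , ends-in-one , subst Balanced (sym (seg-to-shift α k T T<N)) balanced , prefixes
  where
    prefixes : ∀ j → dist k j < dist k (shift k T) → ZeroDominated (seg α k j)
    prefixes j shorter = subst ZeroDominated (sym (seg-as-walk α k j))
      (earlier (dist k j) (subst (dist k j <_) (dist-shift k T T<N) shorter))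

succeeding⇒bound : ∀ {n} (α : Fin (suc n) → Bool) k → α k ≡ false →
  SucceedingOneDominated α k → Bound α k
succeeding⇒bound {n} α k αk≡0 (m , od)
  with first-crossing (walk α k) (suc L) (trans (walk-zero α k) αk≡0) not-zd
  where
    L = dist (shift k 1) m
    not-zd : ¬ ZeroDominated (applyUpTo (walk α k) (suc (suc L)))
    not-zd = subst (λ b → ¬ ZeroDominated (b ∷ applyUpTo (walk α k ∘ suc) (suc L)))
      (sym (trans (walk-zero α k) αk≡0))
      (one-dominated-cons (applyUpTo (walk α k ∘ suc) (suc L)) (subst OneDominated (seg-succeeding α k m) od))
... | T , T<L+2 , crossing@(ends-in-one , _) =
  shift k T , inj₁ (crossing⇒connected α k T αk≡0 T<N crossing)
  where
    T<N : T < suc n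
    T<N = crossing-before-full-turn α k T αk≡0
      (≤-trans (s≤s⁻¹ T<L+2) (dist<n (shift k 1) m)) ends-in-one

-- Lemma 2.  (For n = 0 there is no position k, so only n ≥ 1 needs a proof.)
lemma2 : ∀ {n : ℕ} (α : Fin n → Bool) (k : Fin n) → α k ≡ false →
    (Bound α k → SucceedingOneDominated α k) × (SucceedingOneDominated α k → Bound α k)
lemma2 {suc n} α k αk≡0 = bound⇒succeeding α k αk≡0 , succeeding⇒bound α k αk≡0
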